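{- For any positive integer $d$ and any integer $s\ge -d+1$, $$N_{d,1}(s)=\sum_{\mu=0}^{\left\lceil \frac{s-1}{d+1}\right\rceil}\binom{s+d-d\mu-1}{\mu}.$$
   Context: A partition $\lambda=(\lambda_1,\dots,\lambda_k)$ is a finite nonincreasing sequence of positive integers (the empty partition is allowed). In its Young diagram, the hook length of a cell is $1$ plus the number of cells to its right in its row plus the number of cells below it in its column. For a positive integer $t$, $\lambda$ is $t$-core if no cell has hook length $t$; $(s,s+1)$-core means both $s$-core and $(s+1)$-core. $\lambda$ has $d$-distinct parts if $\lambda_i-\lambda_{i+1}\ge d$ for all $1\le i\le k-1$. For positive $s$, $N_{d,1}(s)$ is the number of $(s,s+1)$-core partitions with $d$-distinct parts. A set $S\subseteq\mathbb{Z}$ is $d$-th order twin-free if $|x-y|>d$ for all distinct $x,y\in S$. For integers $s\le 0$, $N_{d,1}(s)$ is defined as the number of subsets $\beta\subseteq\{1,\dots,s\}$ (the empty set only, since $s\le 0$) such that $x-s\in\beta$ for all $x\in\beta$ with $x\ge s$, $x-(s+1)\in\beta$ for all $x\in\beta$ with $x\ge s+1$, and $\beta$ is $d$-th order twin-free; thus $N_{d,1}(s)=1$ for $s\le 0$. $\lceil x\rceil$ is the least integer $\ge x$, and $\binom{m}{k}=0$ when $k>m\ge0$. -}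

module Defs where

open import Data.Nat as ℕ using (ℕ; zero; suc; _<_; _≤_; _<ᵇ_)
open import Data.Nat.Combinatorics using (_C_)
open import Data.Integer as ℤ using (ℤ; +_; -[1+_]; -_; _/ℕ_)
open import Data.List using (List; []; _∷_; length; filter)
open import Data.List.Relation.Unary.All using (All)
open import Data.List.Relation.Unary.Linked using (Linked)
open import Data.List.Relation.Unary.Unique.Propositional using (Unique)
open import Data.List.Membership.Propositional using (_∈_)
open import Data.Product using (_×_; Σ; ∃)
open import Function.Bundles using (_⇔_)
open import Relation.Binary.PropositionalEquality using (_≡_; _≢_)
open import Relation.Unary using (Pred)
open import Data.Nat.Properties using (_<?_)
open import Level using (0ℓ)

IsPartition : List ℕ → Set
IsPartition p = All (λ a → 1 ≤ a) p × Linked (λ a b → b ≤ a) p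

-- i-th part (0-indexed); 0 beyond the last part.
part : List ℕ → ℕ → ℕ
part []      _       = 0
part (a ∷ _) zero    = a
part (_ ∷ p) (suc i) = part p i

colLen : List ℕ → ℕ → ℕ
colLen p j = length (filter (λ a → j <? a) p)

-- Cells of the Young diagram: (i , j) (0-indexed) with j < λ_i.
-- Hook length of cell (i , j):
--   1 + (cells to the right: λ_i - j - 1) + (cells below: λ'_j - i - 1)
hook : List ℕ → ℕ → ℕ → ℕ
hook p i j = 1 ℕ.+ ((part p i ℕ.∸ j) ℕ.∸ 1) ℕ.+ ((colLen p j ℕ.∸ i) ℕ.∸ 1)

IsCore : ℕ → List ℕ → Set
IsCore t p = ∀ i j → j < part p i → hook p i j ≢ t

DDistinct : ℕ → List ℕ → Set
DDistinct d p = Linked (λ a b → b ℕ.+ d ≤ a) p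

Counted : ℕ → ℕ → List ℕ → Set
Counted d s p = IsPartition p × IsCore s p × IsCore (suc s) p × DDistinct d p

-- For s ≤ 0: by the paper's convention N_{d,1}(s) = 1.
N-is : ℕ → ℤ → ℕ → Set
N-is d (+ suc s) n =
  Σ (List (List ℕ)) λ L → Unique L × (∀ p → (p ∈ L) ⇔ Counted d (suc s) p) × length L ≡ n
N-is d (+ zero)   n = n ≡ 1
N-is d -[1+ _ ]   n = n ≡ 1

-- ⌈ a / (d+1) ⌉ for an integer a
ceilDivSuc : ℤ → ℕ → ℤ
ceilDivSuc a d = - ((- a) /ℕ suc d)

sumUpTo : ℤ → (ℕ → ℕ) → ℕ
sumUpTo -[1+ _ ] f = 0
sumUpTo (+ n)    f = go n
  where
  go : ℕ → ℕ
  go zero    = f 0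
  go (suc m) = go m ℕ.+ f (suc m)

-- right-hand side: Σ_{μ=0}^{⌈(s-1)/(d+1)⌉} binom(s+d-dμ-1, μ)
-- (the top argument is ≥ μ ≥ 0 throughout the range, so ∣_∣ is exact)
rhs : ℕ → ℤ → ℕ
rhs d s = sumUpTo (ceilDivSuc (s ℤ.- + 1) d)
  (λ μ → ℤ.∣ s ℤ.+ + d ℤ.- + (d ℕ.* μ) ℤ.- + 1 ∣ C μ)

-- For a partition with distinct parts, the hook lengths along the first row decrease by at
-- most 2 per step (distinct parts make the column lengths drop by at most 1 per step), from
-- λ₁ + k − 1 down to below s; so they avoid both s and s + 1 only if λ₁ + k − 1 < s, while
-- no hook length exceeds λ₁ + k − 1. Hence N_{d,1}(s) counts the partitions with d-distinct
-- parts and λ₁ + k ≤ s. Splitting those with μ parts on whether λ₁ + k = s (then λ₁ is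
-- forced and the other parts form such a partition for s − 1 − d) gives Pascal's rule for
-- binom(s + d − dμ − 1, μ). Finally λ₁ > d(μ − 1) forces μ(d + 1) ≤ s + d − 1, so μ never
-- exceeds ⌈(s − 1)/(d + 1)⌉.
module Submission where

open import Defs
open import Data.Nat
open import Data.Nat.Properties
open import Data.Nat.DivMod using (_/_; _%_; m≡m%n+[m/n]*n; m%n<n; m<n⇒m/n≡0)
open import Data.Nat.Solver using (module +-*-Solver)
open import Data.Nat.Combinatorics using (_C_; nCk+nC[k+1]≡[n+1]C[k+1])
open import Algebra.Properties.CommutativeSemigroup +-commutativeSemigroup using (xy∙z≈xz∙y)
open import Data.Integer as ℤ using (ℤ; +_; -[1+_])
import Data.Integer.Properties as ℤ
open import Data.List using (List; []; _∷_; length; _++_; map)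
open import Data.List.Properties using (filter-accept; filter-reject; filter-none; filter-all; length-filter; length-++; length-map)
open import Data.List.Relation.Unary.All as All using (All; []; _∷_)
open import Data.List.Relation.Unary.Linked as Linked using (Linked; []; [-]; _∷_)
open import Data.List.Relation.Unary.Linked.Properties using (Linked⇒All)
open import Data.List.Relation.Unary.Any using (here)
open import Data.List.Relation.Unary.Unique.Propositional using (Unique)
import Data.List.Relation.Unary.Unique.Propositional.Properties as Unique
open import Data.List.Relation.Unary.AllPairs using ([]; _∷_)
open import Data.List.Membership.Propositional using (_∈_)
open import Data.List.Membership.Propositional.Properties using (∈-++⁻; ∈-++⁺ˡ; ∈-++⁺ʳ; ∈-map⁺; ∈-map⁻)
open import Data.Product using (∃-syntax; _×_; _,_; proj₁; proj₂)
open import Data.Sum as Sum using (_⊎_; inj₁; inj₂)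
open import Function.Base using (_∘′_)
open import Function.Bundles using (_⇔_; mk⇔)
open import Function.Construct.Composition using (_⇔-∘_)
open import Function.Construct.Symmetry using (⇔-sym)
open import Relation.Nullary using (¬_; yes; no; contradiction)
open import Relation.Binary.PropositionalEquality

ceilDivSuc-nonneg : ∀ n d → ∃[ c ] ceilDivSuc (+ n) d ≡ + c × n ≤ c * suc d × c * suc d ≤ n + d
ceilDivSuc-nonneg zero d = 0 , refl , z≤n , z≤n
ceilDivSuc-nonneg (suc t) d with suc t % suc d in rem
... | zero = q , ℤ.neg-involutive (+ q) , ≤-reflexive t≡ , ≤-trans (≤-reflexive (sym t≡)) (m≤m+n _ d)
  where
  q = suc t / suc d
  t≡ : suc t ≡ q * suc d
  t≡ = trans (m≡m%n+[m/n]*n (suc t) (suc d)) (cong (_+ q * suc d) rem)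
... | suc r = suc q , refl , lower , upper
  where
  q = suc t / suc d
  t≡ : suc t ≡ suc r + q * suc d
  t≡ = trans (m≡m%n+[m/n]*n (suc t) (suc d)) (cong (_+ q * suc d) rem)
  lower : suc t ≤ suc q * suc d
  lower = ≤-trans (≤-reflexive t≡) (+-monoˡ-≤ (q * suc d) (<⇒≤ (subst (_< suc d) rem (m%n<n (suc t) (suc d)))))
  upper : suc q * suc d ≤ suc t + d
  upper = begin
    suc d + q * suc d      ≡⟨ +-comm (suc d) _ ⟩
    q * suc d + suc d      ≡⟨ +-suc (q * suc d) d ⟩
    suc (q * suc d + d)    ≤⟨ +-monoˡ-≤ d (m≤n+m (suc (q * suc d)) r) ⟩
    r + suc (q * suc d) + d ≡⟨ cong (_+ d) (+-suc r _) ⟩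
    suc r + q * suc d + d  ≡⟨ cong (_+ d) t≡ ⟨
    suc t + d              ∎
    where open ≤-Reasoning

ceilDivSuc-negative : ∀ {k d} → k < d → ceilDivSuc -[1+ k ] d ≡ + 0
ceilDivSuc-negative k<d = cong (λ q → ℤ.- (+ q)) (m<n⇒m/n≡0 (s≤s k<d))

sumUpTo-cong : ∀ c {f g : ℕ → ℕ} → (∀ μ → μ ≤ c → f μ ≡ g μ) → sumUpTo (+ c) f ≡ sumUpTo (+ c) g
sumUpTo-cong zero f≗g = f≗g 0 z≤n
sumUpTo-cong (suc c) f≗g =
  cong₂ _+_ (sumUpTo-cong c (λ μ μ≤c → f≗g μ (m≤n⇒m≤1+n μ≤c))) (f≗g (suc c) ≤-refl)

∸≤suc[∸suc] : ∀ m n → m ∸ n ≤ suc (m ∸ suc n)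
∸≤suc[∸suc] zero zero = z≤n
∸≤suc[∸suc] zero (suc n) = z≤n
∸≤suc[∸suc] (suc m) zero = ≤-refl
∸≤suc[∸suc] (suc m) (suc n) = ∸≤suc[∸suc] m n

descent-hits : ∀ m (f : ℕ → ℕ) t → t ≤ f 0 → f m < t → (∀ j → j < m → f j ≤ 2 + f (suc j)) →
               ∃[ j ] j < m × (f j ≡ t ⊎ f j ≡ suc t)
descent-hits zero f t t≤f0 fm<t steps = contradiction t≤f0 (<⇒≱ fm<t)
descent-hits (suc m) f t t≤f0 fm<t steps with t ≤? f 1
... | yes t≤f1 =
  let j , j<m , hit = descent-hits m (f ∘′ suc) t t≤f1 fm<t (λ j j<m → steps (suc j) (s≤s j<m))
  in suc j , s≤s j<m , hit
... | no t≰f1 with m≤n⇒m<n∨m≡n t≤f0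
...   | inj₂ t≡f0 = 0 , z<s , inj₁ (sym t≡f0)
...   | inj₁ t<f0 = 0 , z<s , inj₂ (≤-antisym (≤-trans (steps 0 z<s) (s≤s (≰⇒> t≰f1))) t<f0)

colLen-∷-< : ∀ {a p j} → j < a → colLen (a ∷ p) j ≡ suc (colLen p j)
colLen-∷-< {j = j} j<a = cong length (filter-accept (j <?_) j<a)

colLen-∷-≮ : ∀ {a p j} → ¬ j < a → colLen (a ∷ p) j ≡ colLen p j
colLen-∷-≮ {j = j} j≮a = cong length (filter-reject (j <?_) j≮a)

colLen-∷-≤ : ∀ a p j → colLen (a ∷ p) j ≤ suc (colLen p j)
colLen-∷-≤ a p j with j <? a
... | yes j<a = ≤-reflexive (colLen-∷-< j<a)
... | no j≮a = m≤n⇒m≤1+n (≤-reflexive (colLen-∷-≮ j≮a))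

colLen≤length : ∀ p j → colLen p j ≤ length p
colLen≤length p j = length-filter (j <?_) p

colLen-≡0 : ∀ {p j} → All (_≤ j) p → colLen p j ≡ 0
colLen-≡0 {j = j} p≤j = cong length (filter-none (j <?_) (All.map ≤⇒≯ p≤j))

colLen-0 : ∀ {p} → All (1 ≤_) p → colLen p 0 ≡ length p
colLen-0 pos = cong length (filter-all (0 <?_) pos)

tail<head : ∀ {a p} → Linked _>_ (a ∷ p) → All (_< a) p
tail<head [-] = []
tail<head (a>b ∷ lk) = Linked⇒All (λ x>y y>z → <-trans y>z x>y) a>b lk

colLen-≤-suc : ∀ {p} → Linked _>_ p → ∀ j → colLen p j ≤ suc (colLen p (suc j))
colLen-≤-suc [] j = z≤n
colLen-≤-suc {a ∷ p} lk j with suc j <? a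
... | yes j+1<a = begin
  colLen (a ∷ p) j               ≡⟨ colLen-∷-< (<-trans (n<1+n j) j+1<a) ⟩
  suc (colLen p j)               ≤⟨ s≤s (colLen-≤-suc (Linked.tail lk) j) ⟩
  suc (suc (colLen p (suc j)))   ≡⟨ cong suc (colLen-∷-< j+1<a) ⟨
  suc (colLen (a ∷ p) (suc j))   ∎
  where open ≤-Reasoning
... | no j+1≮a = begin
  colLen (a ∷ p) j               ≤⟨ colLen-∷-≤ a p j ⟩
  suc (colLen p j)               ≡⟨ cong suc (colLen-≡0 (All.map (λ b<a → s≤s⁻¹ (≤-trans b<a (≮⇒≥ j+1≮a))) (tail<head lk))) ⟩
  1                              ≤⟨ s≤s z≤n ⟩
  suc (colLen (a ∷ p) (suc j))   ∎
  where open ≤-Reasoning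

hook-first-row : ∀ {a p j} → j < a → hook (a ∷ p) 0 j ≡ (a ∸ j) + colLen p j
hook-first-row {a} {p} {j} j<a rewrite colLen-∷-< {a} {p} {j} j<a =
  cong (_+ colLen p j) (m+[n∸m]≡n (m<n⇒0<n∸m j<a))

part≤head : ∀ {p} → Linked _≥_ p → ∀ i → part p i ≤ part p 0
part≤head [] i = z≤n
part≤head [-] zero = ≤-refl
part≤head [-] (suc i) = z≤n
part≤head (a≥b ∷ lk) zero = ≤-refl
part≤head (a≥b ∷ lk) (suc i) = ≤-trans (part≤head lk i) a≥b

hook<head+length : ∀ {p} → Linked _≥_ p → ∀ i j → j < part p i → hook p i j < part p 0 + length p
hook<head+length {a ∷ p} lk i j j<λᵢ = begin-strict
  1 + ((part (a ∷ p) i ∸ j) ∸ 1) + ((colLen (a ∷ p) j ∸ i) ∸ 1)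
    ≤⟨ +-mono-≤ (s≤s arm≤) leg≤ ⟩
  1 + (a ∸ 1) + length p  ≡⟨ cong (_+ length p) (m+[n∸m]≡n a≥1) ⟩
  a + length p            <⟨ +-monoʳ-< a (n<1+n (length p)) ⟩
  a + length (a ∷ p)      ∎
  where
  open ≤-Reasoning
  λᵢ≤a : part (a ∷ p) i ≤ a
  λᵢ≤a = part≤head lk i
  a≥1 : 1 ≤ a
  a≥1 = ≤-trans (<-≤-trans z<s j<λᵢ) λᵢ≤a
  arm≤ : (part (a ∷ p) i ∸ j) ∸ 1 ≤ a ∸ 1
  arm≤ = ∸-monoˡ-≤ 1 (≤-trans (m∸n≤m _ j) λᵢ≤a)
  leg≤ : (colLen (a ∷ p) j ∸ i) ∸ 1 ≤ length p
  leg≤ = ∸-monoˡ-≤ 1 (≤-trans (m∸n≤m _ i) (colLen≤length (a ∷ p) j))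

head+length≤⇒core : ∀ {t p} → Linked _≥_ p → part p 0 + length p ≤ t → IsCore t p
head+length≤⇒core lk bound i j j<λᵢ = <⇒≢ (<-≤-trans (hook<head+length lk i j j<λᵢ) bound)

first-row-hits : ∀ {s a p} → 1 ≤ s → All (1 ≤_) p → Linked _>_ (a ∷ p) → s < a + length (a ∷ p) →
                 ∃[ j ] j < a × (hook (a ∷ p) 0 j ≡ s ⊎ hook (a ∷ p) 0 j ≡ suc s)
first-row-hits {s} {a} {p} s≥1 pos lk s<a+k =
  let j , j<a , hit = descent-hits a f s s≤f0 fa<s (λ j _ → step j)
  in j , j<a , Sum.map (trans (hook-first-row j<a)) (trans (hook-first-row j<a)) hit
  where
  f : ℕ → ℕ
  f j = (a ∸ j) + colLen p j
  s≤f0 : s ≤ f 0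
  s≤f0 = begin
    s                 ≤⟨ s≤s⁻¹ (≤-trans s<a+k (≤-reflexive (+-suc a (length p)))) ⟩
    a + length p      ≡⟨ cong (λ k → a + k) (colLen-0 pos) ⟨
    f 0               ∎
    where open ≤-Reasoning
  fa<s : f a < s
  fa<s = subst (_< s) (sym (cong₂ _+_ (n∸n≡0 a) (colLen-≡0 (All.map <⇒≤ (tail<head lk))))) s≥1
  step : ∀ j → f j ≤ 2 + f (suc j)
  step j = begin
    (a ∸ j) + colLen p j                      ≤⟨ +-mono-≤ (∸≤suc[∸suc] a j) (colLen-≤-suc (Linked.tail lk) j) ⟩
    suc (a ∸ suc j) + suc (colLen p (suc j))  ≡⟨ cong suc (+-suc _ _) ⟩
    2 + f (suc j)                             ∎
    where open ≤-Reasoning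

core⇒head+length≤ : ∀ {s p} → 1 ≤ s → All (1 ≤_) p → Linked _>_ p →
                    IsCore s p → IsCore (suc s) p → part p 0 + length p ≤ s
core⇒head+length≤ {p = []} _ _ _ _ _ = z≤n
core⇒head+length≤ {s} {a ∷ p} s≥1 (_ ∷ pos) lk s-core s+1-core with a + length (a ∷ p) ≤? s
... | yes bounded = bounded
... | no unbounded with first-row-hits s≥1 pos lk (≰⇒> unbounded)
...   | j , j<a , inj₁ hook≡s = contradiction hook≡s (s-core 0 j j<a)
...   | j , j<a , inj₂ hook≡s+1 = contradiction hook≡s+1 (s+1-core 0 j j<a)

-- The largest hook length of p is part p 0 + length p ∸ 1, so Fits d n p says all hooks are ≤ n.
Fits : ℕ → ℕ → List ℕ → Set
Fits d n p = All (1 ≤_) p × DDistinct d p × part p 0 + length p ≤ suc n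

DDistinct⇒nonincreasing : ∀ {d p} → DDistinct d p → Linked _≥_ p
DDistinct⇒nonincreasing = Linked.map (λ {a} {b} b+d≤a → m+n≤o⇒m≤o b b+d≤a)

DDistinct⇒decreasing : ∀ {d p} → 1 ≤ d → DDistinct d p → Linked _>_ p
DDistinct⇒decreasing d≥1 = Linked.map (λ {a} {b} b+d≤a → <-≤-trans (m<m+n b d≥1) b+d≤a)

counted⇔fits : ∀ {d} → 1 ≤ d → ∀ n p → Counted d (suc n) p ⇔ Fits d n p
counted⇔fits {d} d≥1 n p = mk⇔ to from
  where
  to : Counted d (suc n) p → Fits d n p
  to ((pos , _) , s-core , s+1-core , dd) =
    pos , dd , core⇒head+length≤ z<s pos (DDistinct⇒decreasing d≥1 dd) s-core s+1-core
  from : Fits d n p → Counted d (suc n) p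
  from (pos , dd , bound) =
    (pos , nonincr) , head+length≤⇒core nonincr bound , head+length≤⇒core nonincr (m≤n⇒m≤1+n bound) , dd
    where
    nonincr = DDistinct⇒nonincreasing dd

module _ (d : ℕ) where

  extend : ℕ → List ℕ → List ℕ
  extend n q = (suc n ∸ length q) ∷ q

  -- A partition fitting n + 1 either fits n, or its largest hook is exactly n + 1; in the
  -- latter case its first part is determined by the rest, which fits n ∸ d.
  fits : ℕ → ℕ → List (List ℕ)
  fits n zero = [] ∷ []
  fits zero (suc μ) = []
  fits (suc n) (suc μ) = fits n (suc μ) ++ map (extend n) (fits (n ∸ d) μ)

  length≤bound : ∀ {m q} → Fits d m q → length q ≤ m
  length≤bound {q = []} _ = z≤n
  length≤bound {q = b ∷ r} (b≥1 ∷ _ , _ , bound) = s≤s⁻¹ (≤-trans (+-monoˡ-≤ (length (b ∷ r)) b≥1) bound)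

  head+length-extend : ∀ n q → length q ≤ suc n → (suc n ∸ length q) + length (extend n q) ≡ suc (suc n)
  head+length-extend n q k≤n+1 = trans (+-suc _ (length q)) (cong suc (m∸n+n≡m k≤n+1))

  extend-gap : ∀ {n b r} → Fits d (n ∸ d) (b ∷ r) → b + d ≤ n ∸ length r
  extend-gap {n} {b} {r} (b≥1 ∷ _ , _ , bound) = m+n≤o⇒m≤o∸n (b + d) (begin
    b + d + length r  ≡⟨ xy∙z≈xz∙y b (length r) d ⟨
    b + length r + d  ≤⟨ m≤o∸n⇒m+n≤o (b + length r) d≤n b+l≤n∸d ⟩
    n                 ∎)
    where
    open ≤-Reasoning
    b+l≤n∸d : b + length r ≤ n ∸ d
    b+l≤n∸d = s≤s⁻¹ (≤-trans (≤-reflexive (sym (+-suc b (length r)))) bound)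
    d≤n : d ≤ n
    d≤n = <⇒≤ (m∸n≢0⇒n<m (n>0⇒n≢0 (≤-trans b≥1 (≤-trans (m≤m+n b (length r)) b+l≤n∸d))))

  extend-DDistinct : ∀ {n q} → Fits d (n ∸ d) q → DDistinct d (extend n q)
  extend-DDistinct {q = []} _ = [-]
  extend-DDistinct {q = b ∷ r} fit@(_ , dd , _) = extend-gap fit ∷ dd

  extend-fits : ∀ {n q} → Fits d (n ∸ d) q → Fits d (suc n) (extend n q)
  extend-fits {n} {q} fit@(pos , _ , _) =
    m<n⇒0<n∸m (s≤s k≤n) ∷ pos , extend-DDistinct fit , ≤-reflexive (head+length-extend n q (m≤n⇒m≤1+n k≤n))
    where
    k≤n : length q ≤ n
    k≤n = ≤-trans (length≤bound fit) (m∸n≤m n d)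

  tail-fits : ∀ {n a q} → All (1 ≤_) (a ∷ q) → DDistinct d (a ∷ q) → a + length q ≡ suc n → Fits d (n ∸ d) q
  tail-fits {q = []} (_ ∷ pos) _ _ = pos , [] , z≤n
  tail-fits {n} {a} {b ∷ r} (_ ∷ pos) (b+d≤a ∷ dd) a+k≡n+1 =
    pos , dd , ≤-trans (≤-reflexive (+-suc b (length r))) (s≤s (m+n≤o⇒m≤o∸n (b + length r) (begin
      b + length r + d  ≡⟨ xy∙z≈xz∙y b (length r) d ⟩
      b + d + length r  ≤⟨ +-monoˡ-≤ (length r) b+d≤a ⟩
      a + length r      ≡⟨ suc-injective (trans (sym (+-suc a (length r))) a+k≡n+1) ⟩
      n                 ∎)))
    where open ≤-Reasoning

  fits-weaken : ∀ {n p} → Fits d n p → Fits d (suc n) p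
  fits-weaken (pos , dd , bound) = pos , dd , m≤n⇒m≤1+n bound

  fits-sound : ∀ n μ {p} → p ∈ fits n μ → Fits d n p × length p ≡ μ
  fits-sound n zero (here refl) = ([] , [] , z≤n) , refl
  fits-sound (suc n) (suc μ) p∈ with ∈-++⁻ (fits n (suc μ)) p∈
  ... | inj₁ p∈fits-n =
    let fit , k≡μ = fits-sound n (suc μ) p∈fits-n in fits-weaken fit , k≡μ
  ... | inj₂ p∈extended with ∈-map⁻ (extend n) p∈extended
  ...   | q , q∈ , refl = let fit , k≡μ = fits-sound (n ∸ d) μ q∈ in extend-fits fit , cong suc k≡μ

  cons-complete : ∀ {a q} → (∀ m → Fits d m q → q ∈ fits m (length q)) →
                  ∀ n → Fits d n (a ∷ q) → a ∷ q ∈ fits n (suc (length q))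
  cons-complete _ zero fit with length≤bound fit
  ... | ()
  cons-complete {a} {q} tail-complete (suc n) (pos , dd , bound) with a + length (a ∷ q) ≤? suc n
  ... | yes fits-n = ∈-++⁺ˡ (cons-complete tail-complete n (pos , dd , fits-n))
  ... | no ¬fits-n = ∈-++⁺ʳ (fits n (suc (length q)))
    (subst (λ x → x ∷ q ∈ _) (sym a≡) (∈-map⁺ (extend n) (tail-complete (n ∸ d) (tail-fits pos dd a+k≡n+1))))
    where
    a+k≡n+1 : a + length q ≡ suc n
    a+k≡n+1 = suc-injective (trans (sym (+-suc a (length q))) (≤-antisym bound (≰⇒> ¬fits-n)))
    a≡ : a ≡ suc n ∸ length q
    a≡ = trans (sym (m+n∸n≡m a (length q))) (cong (_∸ length q) a+k≡n+1)

  fits-complete : ∀ n {p} → Fits d n p → p ∈ fits n (length p)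
  fits-complete n {[]} _ = here refl
  fits-complete n {_ ∷ _} = cons-complete (λ m → fits-complete m) n

  fits-unique : ∀ n μ → Unique (fits n μ)
  fits-unique n zero = [] ∷ []
  fits-unique zero (suc μ) = []
  fits-unique (suc n) (suc μ) =
    Unique.++⁺ (fits-unique n (suc μ)) (Unique.map⁺ extend-injective (fits-unique (n ∸ d) μ)) disjoint
    where
    extend-injective : ∀ {q q′} → extend n q ≡ extend n q′ → q ≡ q′
    extend-injective refl = refl
    disjoint : ∀ {p} → ¬ (p ∈ fits n (suc μ) × p ∈ map (extend n) (fits (n ∸ d) μ))
    disjoint (p∈ , p∈extended) with ∈-map⁻ (extend n) p∈extended
    ... | q , q∈ , refl =
      1+n≰n (subst (_≤ suc n) (head+length-extend n q k≤n+1) (proj₂ (proj₂ (proj₁ (fits-sound n (suc μ) p∈)))))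
      where
      k≤n+1 : length q ≤ suc n
      k≤n+1 = ≤-trans (length≤bound (proj₁ (fits-sound (n ∸ d) μ q∈))) (≤-trans (m∸n≤m n d) (n≤1+n n))

  top-suc : ∀ n m → n + d ∸ d * suc m ≡ n ∸ d * m
  top-suc n m = trans (cong₂ _∸_ (+-comm n d) (*-suc d m)) ([m+n]∸[m+o]≡n∸o d n (d * m))

  tail-binomial : ∀ n m → ((n ∸ d) + d ∸ d * m) C m ≡ (n ∸ d * m) C m
  tail-binomial n zero = refl
  tail-binomial n (suc m) = cong (_C suc m) (begin
    n ∸ d + d ∸ d * suc m  ≡⟨ top-suc (n ∸ d) m ⟩
    n ∸ d ∸ d * m          ≡⟨ ∸-+-assoc n d (d * m) ⟩
    n ∸ (d + d * m)        ≡⟨ cong (n ∸_) (*-suc d m) ⟨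
    n ∸ d * suc m          ∎)
    where open ≡-Reasoning

  pascal-step : ∀ n m → (n ∸ d * m) C m + (n ∸ d * m) C suc m ≡ (suc n ∸ d * m) C suc m
  pascal-step n m with d * m ≤? n
  ... | yes dm≤n =
    trans (nCk+nC[k+1]≡[n+1]C[k+1] (n ∸ d * m) m) (cong (_C suc m) (sym (+-∸-assoc 1 dm≤n)))
  pascal-step n zero | no d*0≰n = contradiction (≤-trans (≤-reflexive (*-zeroʳ d)) z≤n) d*0≰n
  pascal-step n (suc m) | no dm≰n rewrite m≤n⇒m∸n≡0 (<⇒≤ (≰⇒> dm≰n)) | m≤n⇒m∸n≡0 (≰⇒> dm≰n) = refl

  length-fits : ∀ n μ → length (fits n μ) ≡ (n + d ∸ d * μ) C μ
  length-fits n zero = refl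
  length-fits zero (suc m) rewrite top-suc 0 m | 0∸n≡0 (d * m) = refl
  length-fits (suc n) (suc m) = begin
    length (fits n (suc m) ++ map (extend n) (fits (n ∸ d) m))
      ≡⟨ length-++ (fits n (suc m)) ⟩
    length (fits n (suc m)) + length (map (extend n) (fits (n ∸ d) m))
      ≡⟨ cong (λ k → length (fits n (suc m)) + k) (length-map (extend n) (fits (n ∸ d) m)) ⟩
    length (fits n (suc m)) + length (fits (n ∸ d) m)
      ≡⟨ cong₂ _+_ (length-fits n (suc m)) (length-fits (n ∸ d) m) ⟩
    (n + d ∸ d * suc m) C suc m + ((n ∸ d) + d ∸ d * m) C m
      ≡⟨ cong₂ _+_ (cong (_C suc m) (top-suc n m)) (tail-binomial n m) ⟩
    (n ∸ d * m) C suc m + (n ∸ d * m) C m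
      ≡⟨ +-comm ((n ∸ d * m) C suc m) _ ⟩
    (n ∸ d * m) C m + (n ∸ d * m) C suc m
      ≡⟨ pascal-step n m ⟩
    (suc n ∸ d * m) C suc m
      ≡⟨ cong (_C suc m) (top-suc (suc n) m) ⟨
    (suc n + d ∸ d * suc m) C suc m
      ∎
    where open ≡-Reasoning

  d*length<head : ∀ {a q} → All (1 ≤_) (a ∷ q) → DDistinct d (a ∷ q) → d * length q < a
  d*length<head {a} {[]} (a≥1 ∷ _) _ = subst (_< a) (sym (*-zeroʳ d)) a≥1
  d*length<head {a} {b ∷ r} (_ ∷ pos) (b+d≤a ∷ dd) = begin-strict
    d * suc (length r)  ≡⟨ *-suc d (length r) ⟩
    d + d * length r    <⟨ +-monoʳ-< d (d*length<head pos dd) ⟩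
    d + b               ≡⟨ +-comm d b ⟩
    b + d               ≤⟨ b+d≤a ⟩
    a                   ∎
    where open ≤-Reasoning

  length*[1+d]≤n+d : ∀ {n p} → Fits d n p → length p * suc d ≤ n + d
  length*[1+d]≤n+d {p = []} _ = z≤n
  length*[1+d]≤n+d {n} {a ∷ q} (pos , dd , bound) = begin
    suc k * suc d      ≡⟨ expand k d ⟩
    suc (d * k) + k + d ≤⟨ +-monoˡ-≤ d (+-monoˡ-≤ k (d*length<head pos dd)) ⟩
    a + k + d          ≤⟨ +-monoˡ-≤ d (s≤s⁻¹ (≤-trans (≤-reflexive (sym (+-suc a k))) bound)) ⟩
    n + d              ∎
    where
    open ≤-Reasoning
    open +-*-Solver
    k = length q
    expand : ∀ k d → suc k * suc d ≡ suc (d * k) + k + d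
    expand = solve 2 (λ k d → (con 1 :+ k) :* (con 1 :+ d) := con 1 :+ d :* k :+ k :+ d) refl

  length≤ceiling : ∀ {n c p} → n ≤ c * suc d → Fits d n p → length p ≤ c
  length≤ceiling {n} {c} {p} n≤c[1+d] fit = s≤s⁻¹ (*-cancelʳ-< (suc d) (length p) (suc c) (begin-strict
    length p * suc d  ≤⟨ length*[1+d]≤n+d fit ⟩
    n + d             ≤⟨ +-monoˡ-≤ d n≤c[1+d] ⟩
    c * suc d + d     <⟨ +-monoʳ-< (c * suc d) (n<1+n d) ⟩
    c * suc d + suc d ≡⟨ +-comm (c * suc d) (suc d) ⟩
    suc c * suc d     ∎))
    where open ≤-Reasoning

  fitsUpTo : ℕ → ℕ → List (List ℕ)
  fitsUpTo n zero = fits n zero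
  fitsUpTo n (suc c) = fitsUpTo n c ++ fits n (suc c)

  ∈-fitsUpTo⁻ : ∀ n c {p} → p ∈ fitsUpTo n c → Fits d n p × length p ≤ c
  ∈-fitsUpTo⁻ n zero p∈ = let fit , k≡0 = fits-sound n zero p∈ in fit , ≤-reflexive k≡0
  ∈-fitsUpTo⁻ n (suc c) p∈ with ∈-++⁻ (fitsUpTo n c) p∈
  ... | inj₁ p∈′ = let fit , k≤c = ∈-fitsUpTo⁻ n c p∈′ in fit , m≤n⇒m≤1+n k≤c
  ... | inj₂ p∈′ = let fit , k≡c+1 = fits-sound n (suc c) p∈′ in fit , ≤-reflexive k≡c+1

  ∈-fitsUpTo⁺ : ∀ n {c μ p} → μ ≤ c → p ∈ fits n μ → p ∈ fitsUpTo n c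
  ∈-fitsUpTo⁺ n {zero} z≤n p∈ = p∈
  ∈-fitsUpTo⁺ n {suc c} μ≤c+1 p∈ with m≤n⇒m<n∨m≡n μ≤c+1
  ... | inj₁ μ<c+1 = ∈-++⁺ˡ (∈-fitsUpTo⁺ n (s≤s⁻¹ μ<c+1) p∈)
  ... | inj₂ refl = ∈-++⁺ʳ (fitsUpTo n c) p∈

  fitsUpTo-ceiling⇔ : ∀ n c → n ≤ c * suc d → ∀ p → p ∈ fitsUpTo n c ⇔ Fits d n p
  fitsUpTo-ceiling⇔ n c n≤c[1+d] p = mk⇔ (λ p∈ → proj₁ (∈-fitsUpTo⁻ n c p∈))
    (λ fit → ∈-fitsUpTo⁺ n {c} (length≤ceiling n≤c[1+d] fit) (fits-complete n fit))

  fitsUpTo-unique : ∀ n c → Unique (fitsUpTo n c)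
  fitsUpTo-unique n zero = fits-unique n zero
  fitsUpTo-unique n (suc c) = Unique.++⁺ (fitsUpTo-unique n c) (fits-unique n (suc c)) disjoint
    where
    disjoint : ∀ {p} → ¬ (p ∈ fitsUpTo n c × p ∈ fits n (suc c))
    disjoint (p∈ , p∈′) =
      1+n≰n (subst (_≤ c) (proj₂ (fits-sound n (suc c) p∈′)) (proj₂ (∈-fitsUpTo⁻ n c p∈)))

  length-fitsUpTo : ∀ n c → length (fitsUpTo n c) ≡ sumUpTo (+ c) (λ μ → (n + d ∸ d * μ) C μ)
  length-fitsUpTo n zero = length-fits n zero
  length-fitsUpTo n (suc c) =
    trans (length-++ (fitsUpTo n c)) (cong₂ _+_ (length-fitsUpTo n c) (length-fits n (suc c)))

rhs-top : ∀ n d μ → d * μ ≤ n + d → ℤ.∣ + suc n ℤ.+ + d ℤ.- + (d * μ) ℤ.- + 1 ∣ ≡ n + d ∸ d * μ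
rhs-top n d μ dμ≤n+d = cong (λ z → ℤ.∣ z ℤ.- + 1 ∣) (begin
  + (suc n + d) ℤ.- + (d * μ)  ≡⟨ ℤ.[+m]-[+n]≡m⊖n (suc n + d) (d * μ) ⟩
  (suc n + d) ℤ.⊖ (d * μ)      ≡⟨ ℤ.⊖-≥ (m≤n⇒m≤1+n dμ≤n+d) ⟩
  + (suc n + d ∸ d * μ)        ≡⟨ cong +_ (+-∸-assoc 1 dμ≤n+d) ⟩
  + suc (n + d ∸ d * μ)        ∎)
  where open ≡-Reasoning

N-is-positive : ∀ d → 1 ≤ d → ∀ n → N-is d (+ suc n) (rhs d (+ suc n))
N-is-positive d d≥1 n with ceilDivSuc-nonneg n d
... | c , ceil≡c , n≤c[1+d] , c[1+d]≤n+d =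
  fitsUpTo d n c , fitsUpTo-unique d n c , enumerates , counts
  where
  enumerates : ∀ p → p ∈ fitsUpTo d n c ⇔ Counted d (suc n) p
  enumerates p = ⇔-sym (counted⇔fits d≥1 n p) ⇔-∘ fitsUpTo-ceiling⇔ d n c n≤c[1+d] p
  dμ≤n+d : ∀ {μ} → μ ≤ c → d * μ ≤ n + d
  dμ≤n+d {μ} μ≤c = begin
    d * μ      ≤⟨ *-monoʳ-≤ d μ≤c ⟩
    d * c      ≡⟨ *-comm d c ⟩
    c * d      ≤⟨ *-monoʳ-≤ c (n≤1+n d) ⟩
    c * suc d  ≤⟨ c[1+d]≤n+d ⟩
    n + d      ∎
    where open ≤-Reasoning
  term : ℕ → ℕ
  term μ = ℤ.∣ + suc n ℤ.+ + d ℤ.- + (d * μ) ℤ.- + 1 ∣ C μ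
  counts : length (fitsUpTo d n c) ≡ rhs d (+ suc n)
  counts = begin
    length (fitsUpTo d n c)
      ≡⟨ length-fitsUpTo d n c ⟩
    sumUpTo (+ c) (λ μ → (n + d ∸ d * μ) C μ)
      ≡⟨ sumUpTo-cong c (λ μ μ≤c → cong (_C μ) (sym (rhs-top n d μ (dμ≤n+d μ≤c)))) ⟩
    sumUpTo (+ c) term
      ≡⟨ cong (λ u → sumUpTo u term) ceil≡c ⟨
    rhs d (+ suc n)
      ∎
    where open ≡-Reasoning

rhs≡1 : ∀ d s → ceilDivSuc (s ℤ.- + 1) d ≡ + 0 → rhs d s ≡ 1
rhs≡1 d s ceil≡0 = cong (λ u → sumUpTo u (λ μ → ℤ.∣ s ℤ.+ + d ℤ.- + (d * μ) ℤ.- + 1 ∣ C μ)) ceil≡0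

lemma3p1 : (d : ℕ) → 1 ≤ d → (s : ℤ) → s ℤ.≥ ℤ.- (+ d) ℤ.+ + 1 → N-is d s (rhs d s)
lemma3p1 d d≥1 (+ suc n) _ = N-is-positive d d≥1 n
lemma3p1 d d≥1 (+ zero) _ = rhs≡1 d (+ 0) (ceilDivSuc-negative d≥1)
lemma3p1 zero () -[1+ _ ] _
lemma3p1 (suc zero) _ -[1+ _ ] ()
-- Here s − 1 normalises to -[1+ suc (k + 0) ].
lemma3p1 (suc (suc d)) _ -[1+ k ] (ℤ.-≤- k≤d) =
  rhs≡1 (suc (suc d)) -[1+ k ] (ceilDivSuc-negative (s≤s (s≤s (≤-trans (≤-reflexive (+-identityʳ k)) k≤d))))
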